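{- Let $\mathcal G$ be any generalized Gabidulin $(n,n,q;n-t+1)$-code and let $A$ be any $m\times n$ matrix over $\mathbb F_q$ of rank $m$, with $t<m\le n$. Then the punctured code $\mathcal P_A(\mathcal G)=\{AM:M\in\mathcal G\}$ is a generalized Gabidulin $(m,n,q;m-t+1)$-code. Conversely, every generalized Gabidulin $(m,n,q;m-t+1)$-code, with $1\le t\le m$, is obtained by puncturing (in this way, with some $m\times n$ matrix of rank $m$) a generalized Gabidulin $(n,n,q;n-t+1)$-code.
   Context: Let $m\le n$. For $\mathbb F_q$-linearly independent $g_0,\ldots,g_{m-1}\in\mathbb F_{q^n}$, an integer $1\le t\le m$, a positive integer $k$ with $\gcd(k,n)=1$, and an $\mathbb F_q$-basis $\{u_0,\ldots,u_{n-1}\}$ of $\mathbb F_{q^n}$, let $\mathcal L^{(k)}_t=\{\sum_{i=0}^{t-1}c_ix^{q^{ki}}:c_i\in\mathbb F_{q^n}\}$. The generalized Gabidulin $(m,n,q;m-t+1)$-code determined by these data is the set of all $m\times n$ matrices over $\mathbb F_q$ whose $i$-th row ($0\le i\le m-1$) is the coordinate vector of $F(g_i)$ with respect to $\{u_0,\ldots,u_{n-1}\}$, for $F$ ranging over $\mathcal L^{(k)}_t$. -}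

module Defs where

open import Level using (0ℓ)
open import Data.Nat as ℕ using (ℕ; zero; suc)
open import Data.Fin using (Fin; zero; suc)
open import Data.Product using (Σ; ∃; _×_; _,_)
open import Relation.Binary.PropositionalEquality using (_≡_; _≢_)
open import Relation.Nullary using (¬_)
open import Algebra.Structures using (IsCommutativeRing)
open import Function.Bundles using (_↔_)
import Data.Nat.GCD
import Data.Fin

record Field : Set₁ where
  infixl 6 _+_
  infixl 7 _*_
  field
    Carrier : Set
    _+_ _*_ : Carrier → Carrier → Carrier
    -_      : Carrier → Carrier
    0# 1#   : Carrier
    isCommutativeRing : IsCommutativeRing _≡_ _+_ _*_ -_ 0# 1#
    0≢1     : 0# ≢ 1#
    inverse : ∀ x → x ≢ 0# → Σ Carrier λ y → x * y ≡ 1#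

  _^_ : Carrier → ℕ → Carrier
  x ^ zero  = 1#
  x ^ suc e = x * (x ^ e)

  ∑ : (n : ℕ) → (Fin n → Carrier) → Carrier
  ∑ zero    f = 0#
  ∑ (suc n) f = f zero + ∑ n (λ i → f (suc i))

open Field public using (Carrier)

HasCard : Field → ℕ → Set
HasCard F c = Fin c ↔ Carrier F

record IsFieldHom (K L : Field) (ι : Carrier K → Carrier L) : Set where
  private
    module K = Field K
    module L = Field L
  field
    +-homo : ∀ a b → ι (a K.+ b) ≡ ι a L.+ ι b
    *-homo : ∀ a b → ι (a K.* b) ≡ ι a L.* ι b
    1-homo : ι K.1# ≡ L.1#

-- Setting: K = F_q, L = F_{q^n}, ι : F_q ↪ F_{q^n}.
record Setting (q n : ℕ) : Set₁ where
  field
    K L    : Field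
    ι      : Carrier K → Carrier L
    ι-hom  : IsFieldHom K L ι
    K-card : HasCard K q
    L-card : HasCard L (q ℕ.^ n)

module _ {q n : ℕ} (S : Setting q n) where
  open Setting S
  private
    module K = Field K
    module L = Field L

  lincomb : (r : ℕ) → (Fin r → Carrier K) → (Fin r → Carrier L) → Carrier L
  lincomb r a v = L.∑ r (λ i → ι (a i) L.* v i)

  LinIndep : (r : ℕ) → (Fin r → Carrier L) → Set
  LinIndep r v = ∀ (a : Fin r → Carrier K) → lincomb r a v ≡ L.0# → ∀ i → a i ≡ K.0#

  IsBasis : (Fin n → Carrier L) → Set
  IsBasis u = LinIndep n u × (∀ x → Σ (Fin n → Carrier K) λ a → lincomb n a u ≡ x)

  linPoly : (k t : ℕ) → (Fin t → Carrier L) → Carrier L → Carrier L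
  linPoly k t c x = L.∑ t (λ i → c i L.* (x L.^ (q ℕ.^ (k ℕ.* Data.Fin.toℕ i))))

  Matrix : ℕ → ℕ → Set
  Matrix r s = Fin r → Fin s → Carrier K

  Code : ℕ → ℕ → Set₁
  Code r s = Matrix r s → Set

  record GGData (m t : ℕ) : Set where
    field
      t-pos   : 1 ℕ.≤ t
      t≤m     : t ℕ.≤ m
      g       : Fin m → Carrier L
      g-indep : LinIndep m g
      k       : ℕ
      k-pos   : 1 ℕ.≤ k
      k-coprime : Data.Nat.GCD.gcd k n ≡ 1
      u       : Fin n → Carrier L
      u-basis : IsBasis u

  -- The code: M belongs iff for some F ∈ L_t^{(k)}, each row i of M is the
  -- coordinate vector of F(g_i) w.r.t. u (i.e. Σ_j M_ij u_j = F(g_i)).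
  GGCode : (m t : ℕ) → GGData m t → Code m n
  GGCode m t D M = Σ (Fin t → Carrier L) λ c →
    ∀ i → lincomb n (M i) u ≡ linPoly k t c (g i)
    where open GGData D

  IsGG : (m t : ℕ) → Code m n → Set
  IsGG m t C = Σ (GGData m t) λ D → ∀ M → (C M → GGCode m t D M) × (GGCode m t D M → C M)

  _·_ : ∀ {r s p} → Matrix r s → Matrix s p → Matrix r p
  _·_ {s = s} A M i j = K.∑ s (λ l → A i l K.* M l j)

  -- an r×s matrix has rank r  ⇔  its r rows are F_q-linearly independent
  HasFullRowRank : (r s : ℕ) → Matrix r s → Set
  HasFullRowRank r s A = ∀ (a : Fin r → Carrier K) →
    (∀ j → K.∑ r (λ i → a i K.* A i j) ≡ K.0#) → ∀ i → a i ≡ K.0#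

  Puncture : ∀ {m} → Matrix m n → Code n n → Code m n
  Puncture A C N = Σ (Matrix n n) λ M → C M × (∀ i j → (A · M) i j ≡ N i j)

module Submission where

-- A generalized Gabidulin code consists of the coordinate matrices of
-- (F(g₀), …, F(g_{m-1})) for F = ∑_{i<t} cᵢ x^{q^{k i}}.  The key fact is that
-- every such F is F_q-linear on F_{q^n}.  Hence puncturing by a full row rank
-- matrix A (replacing M by A M) turns the code on the points g into the code on
-- the points A g, which are again independent.  Conversely the code on m
-- independent points g is the puncturing, by a 0/1 selection matrix, of the
-- code on any n independent points extending g.
--
-- Linearity of F rests on x ↦ x^q being additive on F_{q^n} and fixing F_q.
-- Both are derived from |F_q| = q alone: Fermat's a^q = a (a permutation-product
-- argument), and the vanishing of the binomial coefficients (q choose k) for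
-- 0 < k < q, because ∑_{0<k<q} (q choose k) xᵏ has q roots but only q
-- coefficients.  Extending g to n independent points is a counting argument:
-- m < n elements span only q^m < q^n elements.

open import Defs hiding (Carrier)
open import Level using (0ℓ)
open import Data.Nat as ℕ using (ℕ; zero; suc; _≤_; _<_; _∸_; s≤s; z≤n)
import Data.Nat.Properties as ℕ
open import Data.Nat.Combinatorics using (_C_; nCn≡1)
open import Data.Fin as Fin using (Fin; zero; suc; toℕ; inject₁; fromℕ; fromℕ<)
open import Data.Fin.Properties
  using ( 0≢1+n; suc-injective; toℕ-fromℕ; toℕ-inject₁; toℕ<n; toℕ-fromℕ<
        ; any?; ¬∀⟶∃¬; injective⇒≤; finToFun-funToFin )
import Data.Fin.Permutation as Perm
open import Data.Vec.Functional using (_∷_)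
open import Data.Product using (Σ; _×_; _,_; proj₁; proj₂)
open import Data.Maybe using (nothing)
open import Data.Empty using (⊥-elim)
open import Relation.Nullary using (¬_; Dec; yes; no)
open import Relation.Nullary.Decidable using (map′)
open import Relation.Binary.PropositionalEquality
open import Relation.Binary.Definitions using (DecidableEquality)
open import Algebra.Bundles using (CommutativeRing)
open import Function.Bundles using (_↔_; Inverse)

module FieldFacts (F : Field) where
  open Field F public
  open ≡-Reasoning

  commutativeRing : CommutativeRing 0ℓ 0ℓ
  commutativeRing = record { isCommutativeRing = isCommutativeRing }

  open CommutativeRing commutativeRing public
    using ( +-assoc; +-comm; *-assoc; *-comm; distribʳ
          ; +-identityˡ; +-identityʳ; *-identityˡ; *-identityʳ
          ; -‿inverseˡ; -‿inverseʳ; zeroˡ; zeroʳ; _-_ )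
  open CommutativeRing commutativeRing
    using (ring; semiring; commutativeSemiring)
  open import Algebra.Properties.Ring ring public
    using ( +-cancelˡ; +-identityˡ-unique; +-identityʳ-unique; +-inverseʳ-unique
          ; x∙y⁻¹≈ε⇒x≈y; -‿distribˡ-*; -‿involutive )
  open import Algebra.Properties.Ring ring using ([y-z]x≈yx-zx)
  open import Algebra.Solver.Ring.NaturalCoefficients commutativeSemiring (λ _ _ → nothing) public
    using (solve; _:+_; _:*_; _:=_)
  open import Algebra.Properties.Semiring.Sum semiring
    using (sum; ∑-distrib-+; ∑-comm; *-distribˡ-sum)
  open import Algebra.Properties.Semiring.Mult semiring public
    using () renaming (_×_ to _times_)
  open import Algebra.Properties.Semiring.Mult semiring using (×-assoc-*)
  open import Algebra.Properties.CommutativeSemiring.Exp commutativeSemiring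
    using (^-assocʳ; ^-distrib-*) renaming (_^_ to _^ˢ_)
  open import Algebra.Properties.CommutativeSemiring.Binomial commutativeSemiring
    using (theorem)

  nonzero-factor : ∀ a b → a * b ≡ 0# → a ≢ 0# → b ≡ 0#
  nonzero-factor a b ab≡0 a≢0 with inverse a a≢0
  ... | a⁻¹ , aa⁻¹≡1 = begin
    b              ≡⟨ sym (*-identityˡ b) ⟩
    1# * b         ≡⟨ cong (_* b) (trans (sym aa⁻¹≡1) (*-comm a a⁻¹)) ⟩
    (a⁻¹ * a) * b  ≡⟨ *-assoc a⁻¹ a b ⟩
    a⁻¹ * (a * b)  ≡⟨ cong (a⁻¹ *_) ab≡0 ⟩
    a⁻¹ * 0#       ≡⟨ zeroʳ a⁻¹ ⟩
    0#             ∎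

  *-nonzero : ∀ {a b} → a ≢ 0# → b ≢ 0# → a * b ≢ 0#
  *-nonzero a≢0 b≢0 ab≡0 = b≢0 (nonzero-factor _ _ ab≡0 a≢0)

  private
    difference-annihilates : ∀ a b z → a * z ≡ b * z → (a - b) * z ≡ 0#
    difference-annihilates a b z eq = begin
      (a - b) * z      ≡⟨ [y-z]x≈yx-zx z a b ⟩
      a * z - b * z    ≡⟨ cong (_- b * z) eq ⟩
      b * z - b * z    ≡⟨ -‿inverseʳ (b * z) ⟩
      0#               ∎

  *-cancelʳ : ∀ a b z → z ≢ 0# → a * z ≡ b * z → a ≡ b
  *-cancelʳ a b z z≢0 eq = x∙y⁻¹≈ε⇒x≈y a b
    (nonzero-factor z (a - b) (trans (*-comm z (a - b)) (difference-annihilates a b z eq)) z≢0)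

  distinct-scalars : ∀ a b z → a ≢ b → a * z ≡ b * z → z ≡ 0#
  distinct-scalars a b z a≢b eq = nonzero-factor (a - b) z (difference-annihilates a b z eq)
    (λ a-b≡0 → a≢b (x∙y⁻¹≈ε⇒x≈y a b a-b≡0))

  ∑≡sum : ∀ n (f : Fin n → Carrier) → ∑ n f ≡ sum f
  ∑≡sum zero    f = refl
  ∑≡sum (suc n) f = cong (f zero +_) (∑≡sum n (λ i → f (suc i)))

  ^≡^ˢ : ∀ x n → x ^ n ≡ x ^ˢ n
  ^≡^ˢ x zero    = refl
  ^≡^ˢ x (suc n) = cong (x *_) (^≡^ˢ x n)

  ∑-cong : ∀ n {f g : Fin n → Carrier} → (∀ i → f i ≡ g i) → ∑ n f ≡ ∑ n g
  ∑-cong zero    f≗g = refl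
  ∑-cong (suc n) f≗g = cong₂ _+_ (f≗g zero) (∑-cong n (λ i → f≗g (suc i)))

  ∑-zero : ∀ n (f : Fin n → Carrier) → (∀ i → f i ≡ 0#) → ∑ n f ≡ 0#
  ∑-zero zero    f f≡0 = refl
  ∑-zero (suc n) f f≡0 =
    trans (cong₂ _+_ (f≡0 zero) (∑-zero n (λ i → f (suc i)) (λ i → f≡0 (suc i)))) (+-identityˡ 0#)

  ∑-+ : ∀ n (f g : Fin n → Carrier) → ∑ n (λ i → f i + g i) ≡ ∑ n f + ∑ n g
  ∑-+ n f g = begin
    ∑ n (λ i → f i + g i)  ≡⟨ ∑≡sum n _ ⟩
    sum (λ i → f i + g i)  ≡⟨ ∑-distrib-+ f g ⟩
    sum f + sum g          ≡⟨ sym (cong₂ _+_ (∑≡sum n f) (∑≡sum n g)) ⟩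
    ∑ n f + ∑ n g          ∎

  ∑-*ˡ : ∀ n a (f : Fin n → Carrier) → a * ∑ n f ≡ ∑ n (λ i → a * f i)
  ∑-*ˡ n a f = begin
    a * ∑ n f              ≡⟨ cong (a *_) (∑≡sum n f) ⟩
    a * sum f              ≡⟨ *-distribˡ-sum a f ⟩
    sum (λ i → a * f i)    ≡⟨ sym (∑≡sum n _) ⟩
    ∑ n (λ i → a * f i)    ∎

  ∑-*ʳ : ∀ n a (f : Fin n → Carrier) → ∑ n f * a ≡ ∑ n (λ i → f i * a)
  ∑-*ʳ n a f = trans (*-comm _ a) (trans (∑-*ˡ n a f) (∑-cong n (λ i → *-comm a (f i))))

  ∑-swap : ∀ m n (f : Fin m → Fin n → Carrier) →
    ∑ m (λ i → ∑ n (f i)) ≡ ∑ n (λ j → ∑ m (λ i → f i j))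
  ∑-swap m n f = begin
    ∑ m (λ i → ∑ n (f i))            ≡⟨ trans (∑-cong m (λ i → ∑≡sum n (f i))) (∑≡sum m _) ⟩
    sum (λ i → sum (f i))            ≡⟨ ∑-comm f ⟩
    sum (λ j → sum (λ i → f i j))    ≡⟨ sym (trans (∑-cong n (λ j → ∑≡sum m _)) (∑≡sum n _)) ⟩
    ∑ n (λ j → ∑ m (λ i → f i j))    ∎

  ∑-last : ∀ n (f : Fin (suc n) → Carrier) → ∑ (suc n) f ≡ ∑ n (λ i → f (inject₁ i)) + f (fromℕ n)
  ∑-last zero    f = trans (+-identityʳ (f zero)) (sym (+-identityˡ (f zero)))
  ∑-last (suc n) f = trans (cong (f zero +_) (∑-last n (λ i → f (suc i)))) (sym (+-assoc (f zero) _ _))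

  ^-* : ∀ x m n → x ^ (m ℕ.* n) ≡ (x ^ m) ^ n
  ^-* x m n = begin
    x ^ (m ℕ.* n)       ≡⟨ ^≡^ˢ x (m ℕ.* n) ⟩
    x ^ˢ (m ℕ.* n)      ≡⟨ sym (^-assocʳ x m n) ⟩
    (x ^ˢ m) ^ˢ n       ≡⟨ sym (trans (^≡^ˢ (x ^ m) n) (cong (_^ˢ n) (^≡^ˢ x m))) ⟩
    (x ^ m) ^ n         ∎

  *-^ : ∀ x y n → (x * y) ^ n ≡ x ^ n * y ^ n
  *-^ x y n = begin
    (x * y) ^ n         ≡⟨ ^≡^ˢ (x * y) n ⟩
    (x * y) ^ˢ n        ≡⟨ ^-distrib-* x y n ⟩
    x ^ˢ n * y ^ˢ n     ≡⟨ sym (cong₂ _*_ (^≡^ˢ x n) (^≡^ˢ y n)) ⟩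
    x ^ n * y ^ n       ∎

  1^ : ∀ n → 1# ^ n ≡ 1#
  1^ zero    = refl
  1^ (suc n) = trans (*-identityˡ _) (1^ n)

  times-scalar : ∀ m w → m times w ≡ (m times 1#) * w
  times-scalar m w = sym (trans (×-assoc-* m 1# w) (cong (m times_) (*-identityˡ w)))

  binomial-theorem : ∀ n x y →
    (x + y) ^ n ≡ ∑ (suc n) (λ k → (n C toℕ k) times (x ^ toℕ k * y ^ (n ∸ toℕ k)))
  binomial-theorem n x y = begin
    (x + y) ^ n     ≡⟨ ^≡^ˢ (x + y) n ⟩
    (x + y) ^ˢ n    ≡⟨ theorem n x y ⟩
    sum termˢ       ≡⟨ sym (∑≡sum (suc n) termˢ) ⟩
    ∑ (suc n) termˢ ≡⟨ ∑-cong (suc n) (λ k → cong ((n C toℕ k) times_)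
                         (sym (cong₂ _*_ (^≡^ˢ x (toℕ k)) (^≡^ˢ y (n ∸ toℕ k))))) ⟩
    ∑ (suc n) term  ∎
    where
    termˢ term : Fin (suc n) → Carrier
    termˢ k = (n C toℕ k) times (x ^ˢ toℕ k * y ^ˢ (n ∸ toℕ k))
    term k = (n C toℕ k) times (x ^ toℕ k * y ^ (n ∸ toℕ k))

  δ : ∀ {n} → Fin n → Fin n → Carrier
  δ zero    zero    = 1#
  δ zero    (suc _) = 0#
  δ (suc _) zero    = 0#
  δ (suc i) (suc j) = δ i j

  δ-diagonal : ∀ {n} (i : Fin n) → δ i i ≡ 1#
  δ-diagonal zero    = refl
  δ-diagonal (suc i) = δ-diagonal i

  δ-off-diagonal : ∀ {n} (i j : Fin n) → i ≢ j → δ i j ≡ 0#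
  δ-off-diagonal zero    zero    i≢j = ⊥-elim (i≢j refl)
  δ-off-diagonal zero    (suc j) i≢j = refl
  δ-off-diagonal (suc i) zero    i≢j = refl
  δ-off-diagonal (suc i) (suc j) i≢j = δ-off-diagonal i j (λ i≡j → i≢j (cong suc i≡j))

  ∑-δ : ∀ n (j : Fin n) (f : Fin n → Carrier) → ∑ n (λ l → δ j l * f l) ≡ f j
  ∑-δ (suc n) zero    f = begin
    1# * f zero + ∑ n (λ l → 0# * f (suc l))
      ≡⟨ cong₂ _+_ (*-identityˡ (f zero)) (∑-zero n _ (λ l → zeroˡ (f (suc l)))) ⟩
    f zero + 0#   ≡⟨ +-identityʳ (f zero) ⟩
    f zero        ∎
  ∑-δ (suc n) (suc j) f = begin
    0# * f zero + ∑ n (λ l → δ j l * f (suc l))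
      ≡⟨ cong₂ _+_ (zeroˡ (f zero)) (∑-δ n j (λ l → f (suc l))) ⟩
    0# + f (suc j)  ≡⟨ +-identityˡ _ ⟩
    f (suc j)       ∎

∑-additive : (K L : Field) (φ : Field.Carrier K → Field.Carrier L) →
  (∀ a b → φ (Field._+_ K a b) ≡ Field._+_ L (φ a) (φ b)) → φ (Field.0# K) ≡ Field.0# L →
  ∀ n (f : Fin n → Field.Carrier K) → φ (Field.∑ K n f) ≡ Field.∑ L n (λ i → φ (f i))
∑-additive K L φ φ-+ φ-0 zero    f = φ-0
∑-additive K L φ φ-+ φ-0 (suc n) f =
  trans (φ-+ _ _) (cong (Field._+_ L (φ (f zero))) (∑-additive K L φ φ-+ φ-0 n (λ i → f (suc i))))

module Polynomial (F : Field) where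
  open FieldFacts F
  open ≡-Reasoning

  horner : ∀ N → (Fin N → Carrier) → Carrier → Carrier
  horner zero    c x = 0#
  horner (suc N) c x = c zero + x * horner N (λ i → c (suc i)) x

  horner≡∑ : ∀ N c x → horner N c x ≡ ∑ N (λ k → c k * x ^ toℕ k)
  horner≡∑ zero    c x = refl
  horner≡∑ (suc N) c x = cong₂ _+_ (sym (*-identityʳ (c zero))) (begin
    x * horner N (λ i → c (suc i)) x            ≡⟨ cong (x *_) (horner≡∑ N (λ i → c (suc i)) x) ⟩
    x * ∑ N (λ k → c (suc k) * x ^ toℕ k)       ≡⟨ ∑-*ˡ N x _ ⟩
    ∑ N (λ k → x * (c (suc k) * x ^ toℕ k))     ≡⟨ ∑-cong N (λ k → solve 3
      (λ x a b → x :* (a :* b) := a :* (x :* b)) refl x (c (suc k)) (x ^ toℕ k)) ⟩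
    ∑ N (λ k → c (suc k) * (x * x ^ toℕ k))     ∎)

  -- Synthetic division by (x - r): p(x) = remainder + (x - r) · quotient(x).
  module Division (r : Carrier) where
    remainder : ∀ N → (Fin (suc N) → Carrier) → Carrier
    remainder zero    c = c zero
    remainder (suc N) c = c zero + r * remainder N (λ i → c (suc i))

    quotient : ∀ N → (Fin (suc N) → Carrier) → Fin N → Carrier
    quotient (suc N) c zero    = remainder N (λ i → c (suc i))
    quotient (suc N) c (suc i) = quotient N (λ i → c (suc i)) i

    -- The division identity, with the subtraction moved to the other side.
    division : ∀ N c x →
      horner (suc N) c x + r * horner N (quotient N c) x ≡ remainder N c + x * horner N (quotient N c) x
    division zero    c x = trans (cong ((c zero + x * 0#) +_) (zeroʳ r)) (+-identityʳ _)
    division (suc N) c x = begin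
      (c zero + x * p′) + r * (ρ + x * Q)
        ≡⟨ solve 6 (λ c₀ x p′ r ρ Q → (c₀ :+ x :* p′) :+ r :* (ρ :+ x :* Q)
                                    := (c₀ :+ r :* ρ) :+ x :* (p′ :+ r :* Q)) refl (c zero) x p′ r ρ Q ⟩
      (c zero + r * ρ) + x * (p′ + r * Q)
        ≡⟨ cong (λ z → (c zero + r * ρ) + x * z) (division N c′ x) ⟩
      (c zero + r * ρ) + x * (ρ + x * Q) ∎
      where
      c′ = λ i → c (suc i)
      p′ = horner (suc N) c′ x
      ρ  = remainder N c′
      Q  = horner N (quotient N c′) x

    remainder≡value : ∀ N c → remainder N c ≡ horner (suc N) c r
    remainder≡value N c = sym (+-cancelʳ′ (division N c r))
      where
      +-cancelʳ′ : ∀ {a b} → a + r * horner N (quotient N c) r ≡ b + r * horner N (quotient N c) r → a ≡ b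
      +-cancelʳ′ {a} {b} eq = +-cancelˡ _ a b (trans (+-comm _ a) (trans eq (+-comm b _)))

    zero-division : ∀ N c → remainder N c ≡ 0# → (∀ i → quotient N c i ≡ 0#) → ∀ i → c i ≡ 0#
    zero-division zero    c ρ≡0 Q≡0 zero    = ρ≡0
    zero-division (suc N) c ρ≡0 Q≡0 zero    = begin
      c zero                                  ≡⟨ sym (+-identityʳ _) ⟩
      c zero + 0#                             ≡⟨ cong (c zero +_) (sym (zeroʳ r)) ⟩
      c zero + r * 0#                         ≡⟨ cong (λ z → c zero + r * z) (sym (Q≡0 zero)) ⟩
      c zero + r * remainder N (λ i → c (suc i)) ≡⟨ ρ≡0 ⟩
      0#                                      ∎
    zero-division (suc N) c ρ≡0 Q≡0 (suc i) =
      zero-division N (λ i → c (suc i)) (Q≡0 zero) (λ i → Q≡0 (suc i)) i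

  -- A polynomial with N coefficients vanishing at N distinct points is zero:
  -- divide by x - p₀ and apply induction to the quotient at the other points.
  root-bound : ∀ N (c : Fin N → Carrier) (p : Fin N → Carrier) →
    (∀ i j → p i ≡ p j → i ≡ j) → (∀ j → horner N c (p j) ≡ 0#) → ∀ i → c i ≡ 0#
  root-bound (suc N) c p p-injective roots = zero-division N c ρ≡0 Q≡0
    where
    open Division (p zero)
    ρ≡0 : remainder N c ≡ 0#
    ρ≡0 = trans (remainder≡value N c) (roots zero)
    quotient-roots : ∀ j → horner N (quotient N c) (p (suc j)) ≡ 0#
    quotient-roots j = distinct-scalars (p zero) (p (suc j)) Q
      (λ e → 0≢1+n (p-injective zero (suc j) e))
      (+-cancelˡ 0# _ _ (begin
        0# + p zero * Q                            ≡⟨ cong (_+ p zero * Q) (sym (roots (suc j))) ⟩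
        horner (suc N) c (p (suc j)) + p zero * Q  ≡⟨ division N c (p (suc j)) ⟩
        remainder N c + p (suc j) * Q              ≡⟨ cong (_+ p (suc j) * Q) ρ≡0 ⟩
        0# + p (suc j) * Q                         ∎))
      where Q = horner N (quotient N c) (p (suc j))
    Q≡0 : ∀ i → quotient N c i ≡ 0#
    Q≡0 = root-bound N (quotient N c) (λ i → p (suc i))
      (λ i j e → suc-injective (p-injective (suc i) (suc j) e)) quotient-roots

module FiniteField (F : Field) (c : ℕ) (card : Fin c ↔ Field.Carrier F) where
  open FieldFacts F
  open Inverse card public using (to; from; strictlyInverseˡ; strictlyInverseʳ)
  open import Algebra.Properties.CommutativeMonoid.Sum (CommutativeRing.*-commutativeMonoid commutativeRing)
    using () renaming ( sum to ∏; ∑-distrib-+ to ∏-distrib; sum-permute to ∏-permute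
                      ; sum-replicate to ∏-replicate; sum-cong-≗ to ∏-cong )
  open ≡-Reasoning

  _≟_ : DecidableEquality Carrier
  x ≟ y with from x Fin.≟ from y
  ... | yes fx≡fy = yes (trans (sym (strictlyInverseˡ x)) (trans (cong to fx≡fy) (strictlyInverseˡ y)))
  ... | no  fx≢fy = no (λ x≡y → fx≢fy (cong from x≡y))

  to-injective : ∀ i j → to i ≡ to j → i ≡ j
  to-injective i j eq = trans (sym (strictlyInverseʳ i)) (trans (cong from eq) (strictlyInverseʳ j))

  from-injective : ∀ x y → from x ≡ from y → x ≡ y
  from-injective x y eq = trans (sym (strictlyInverseˡ x)) (trans (cong to eq) (strictlyInverseˡ y))

  -- A field has the two distinct elements 0 and 1, so c ≥ 2.
  card≡2+ : Σ ℕ λ c′ → c ≡ suc (suc c′)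
  card≡2+ = shape c card
    where
    shape : ∀ d → Fin d ↔ Carrier → Σ ℕ λ d′ → d ≡ suc (suc d′)
    shape zero          e with Inverse.from e 0#
    ... | ()
    shape (suc zero)    e = ⊥-elim (0≢1 (trans (sym (Inverse.strictlyInverseˡ e 0#))
      (trans (cong (Inverse.to e) (single-point (Inverse.from e 0#) (Inverse.from e 1#)))
             (Inverse.strictlyInverseˡ e 1#))))
      where
      single-point : (i j : Fin 1) → i ≡ j
      single-point zero zero = refl
    shape (suc (suc d′)) e = d′ , refl

  0^card : 0# ^ c ≡ 0#
  0^card = subst (λ d → 0# ^ d ≡ 0#) (sym (proj₂ card≡2+)) (zeroˡ _)

  ifZero : Carrier → Carrier → Carrier → Carrier
  ifZero y u v with y ≟ 0#
  ... | yes _ = u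
  ... | no  _ = v

  ifZero-zero : ∀ {y} u v → y ≡ 0# → ifZero y u v ≡ u
  ifZero-zero {y} u v y≡0 with y ≟ 0#
  ... | yes _   = refl
  ... | no  y≢0 = ⊥-elim (y≢0 y≡0)

  ifZero-nonzero : ∀ {y} u v → y ≢ 0# → ifZero y u v ≡ v
  ifZero-nonzero {y} u v y≢0 with y ≟ 0#
  ... | yes y≡0 = ⊥-elim (y≢0 y≡0)
  ... | no  _   = refl

  ∏-nonzero : ∀ {N} (f : Fin N → Carrier) → (∀ i → f i ≢ 0#) → ∏ f ≢ 0#
  ∏-nonzero {zero}  f f≢0 = λ 1≡0 → 0≢1 (sym 1≡0)
  ∏-nonzero {suc N} f f≢0 = *-nonzero (f≢0 zero) (∏-nonzero (λ i → f (suc i)) (λ i → f≢0 (suc i)))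

  ∏-ones : ∀ {N} (f : Fin N → Carrier) → (∀ i → f i ≡ 1#) → ∏ f ≡ 1#
  ∏-ones {zero}  f f≡1 = refl
  ∏-ones {suc N} f f≡1 = trans (cong₂ _*_ (f≡1 zero) (∏-ones (λ i → f (suc i)) (λ i → f≡1 (suc i))))
                               (*-identityˡ 1#)

  ∏-hits-zero-once : ∀ {N} (e : Fin N → Carrier) → (∀ i j → e i ≡ e j → i ≡ j) →
    ∀ j → e j ≡ 0# → ∀ a → ∏ (λ i → ifZero (e i) a 1#) ≡ a
  ∏-hits-zero-once e e-inj zero    e₀≡0 a = trans
    (cong₂ _*_ (ifZero-zero a 1# e₀≡0)
      (∏-ones _ (λ i → ifZero-nonzero a 1# (λ eᵢ≡0 → 0≢1+n (e-inj zero (suc i) (trans e₀≡0 (sym eᵢ≡0)))))))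
    (*-identityʳ a)
  ∏-hits-zero-once e e-inj (suc j) eⱼ≡0 a = trans
    (cong₂ _*_ (ifZero-nonzero a 1# (λ e₀≡0 → 0≢1+n (e-inj zero (suc j) (trans e₀≡0 (sym eⱼ≡0)))))
      (∏-hits-zero-once (λ i → e (suc i)) (λ i k eq → suc-injective (e-inj (suc i) (suc k) eq)) j eⱼ≡0 a))
    (*-identityˡ a)

  -- Fermat for a ≠ 0.  Multiplication by a permutes F, so the product P of the
  -- nonzero parts of all elements satisfies P = S · P, where S = ∏_y s(y) with
  -- s(y) = a for y ≠ 0 and 1 for y = 0; as P ≠ 0, S = 1.  Writing a = s(y) t(y)
  -- for every y, where t(y) = a only at y = 0, gives a^c = S · a = a.
  module _ (a : Carrier) (a≢0 : a ≢ 0#) where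
    private
      a⁻¹ = proj₁ (inverse a a≢0)
      aa⁻¹≡1 = proj₂ (inverse a a≢0)

      scale-by : Carrier → Fin c → Fin c
      scale-by b i = from (b * to i)

      cancel-scaling : ∀ b b′ → b * b′ ≡ 1# → ∀ i → scale-by b (scale-by b′ i) ≡ i
      cancel-scaling b b′ bb′≡1 i = begin
        from (b * to (from (b′ * to i)))  ≡⟨ cong (λ z → from (b * z)) (strictlyInverseˡ _) ⟩
        from (b * (b′ * to i))            ≡⟨ cong from (sym (*-assoc b b′ (to i))) ⟩
        from ((b * b′) * to i)            ≡⟨ cong (λ z → from (z * to i)) bb′≡1 ⟩
        from (1# * to i)                  ≡⟨ cong from (*-identityˡ _) ⟩
        from (to i)                       ≡⟨ strictlyInverseʳ i ⟩
        i                                 ∎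

      scaling : Perm.Permutation c c
      scaling = Perm.permutation (scale-by a) (scale-by a⁻¹)
        (cancel-scaling a a⁻¹ aa⁻¹≡1) (cancel-scaling a⁻¹ a (trans (*-comm a⁻¹ a) aa⁻¹≡1))

      nonzero-part s t : Carrier → Carrier
      nonzero-part y = ifZero y 1# y
      s y = ifZero y 1# a
      t y = ifZero y a 1#

      a≡s*t : ∀ y → a ≡ s y * t y
      a≡s*t y with y ≟ 0#
      ... | yes _ = sym (*-identityˡ a)
      ... | no  _ = sym (*-identityʳ a)

      nonzero-part≢0 : ∀ y → nonzero-part y ≢ 0#
      nonzero-part≢0 y with y ≟ 0#
      ... | yes _   = λ 1≡0 → 0≢1 (sym 1≡0)
      ... | no  y≢0 = y≢0

      nonzero-part-scaled : ∀ y → nonzero-part (a * y) ≡ s y * nonzero-part y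
      nonzero-part-scaled y with y ≟ 0#
      ... | yes y≡0 = trans (ifZero-zero 1# (a * y) (trans (cong (a *_) y≡0) (zeroʳ a))) (sym (*-identityˡ 1#))
      ... | no  y≢0 = ifZero-nonzero 1# (a * y) (*-nonzero a≢0 y≢0)

      P S : Carrier
      P = ∏ (λ i → nonzero-part (to i))
      S = ∏ (λ i → s (to i))

      P≡S*P : P ≡ S * P
      P≡S*P = begin
        P                                          ≡⟨ ∏-permute (λ i → nonzero-part (to i)) scaling ⟩
        ∏ (λ i → nonzero-part (to (scale-by a i)))  ≡⟨ ∏-cong {c} (λ i → cong nonzero-part (strictlyInverseˡ _)) ⟩
        ∏ (λ i → nonzero-part (a * to i))          ≡⟨ ∏-cong {c} (λ i → nonzero-part-scaled (to i)) ⟩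
        ∏ (λ i → s (to i) * nonzero-part (to i))   ≡⟨ ∏-distrib (λ i → s (to i)) (λ i → nonzero-part (to i)) ⟩
        S * P                                      ∎

      S≡1 : S ≡ 1#
      S≡1 = *-cancelʳ S 1# P (∏-nonzero _ (λ i → nonzero-part≢0 (to i)))
              (trans (sym P≡S*P) (sym (*-identityˡ P)))

    fermat-nonzero : a ^ c ≡ a
    fermat-nonzero = begin
      a ^ c                              ≡⟨ trans (^≡^ˢ a c) (sym (∏-replicate c {a})) ⟩
      ∏ {c} (λ _ → a)                    ≡⟨ ∏-cong {c} (λ i → a≡s*t (to i)) ⟩
      ∏ (λ i → s (to i) * t (to i))      ≡⟨ ∏-distrib (λ i → s (to i)) (λ i → t (to i)) ⟩
      S * ∏ (λ i → t (to i))             ≡⟨ cong (_* ∏ (λ i → t (to i))) S≡1 ⟩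
      1# * ∏ (λ i → t (to i))            ≡⟨ *-identityˡ _ ⟩
      ∏ (λ i → t (to i))                 ≡⟨ ∏-hits-zero-once to to-injective (from 0#) (strictlyInverseˡ 0#) a ⟩
      a                                  ∎

  fermat : ∀ a → a ^ c ≡ a
  fermat a with a ≟ 0#
  ... | yes refl  = 0^card
  ... | no  a≢0   = fermat-nonzero a a≢0

-- For each a, expanding (a + 1)^c = a + 1 (Fermat) shows that the
-- polynomial ∑_{0<k<c} (c choose k) x^k has every element as a root; having
-- only c coefficients, it is zero by the root bound.
module BinomialCoefficients (F : Field) where
  open FieldFacts F
  open Polynomial F
  open ≡-Reasoning

  binomial-vanishes : ∀ c → Fin c ↔ Carrier → ∀ k → 0 < k → k < c → (c C k) times 1# ≡ 0#
  binomial-vanishes (suc c₁) card (suc k) _ (s≤s k<c₁) = begin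
    B (suc k)                                 ≡⟨ cong (λ j → B (suc j)) (sym (toℕ-fromℕ< k<c₁)) ⟩
    coefficient (suc (fromℕ< k<c₁))           ≡⟨ root-bound c coefficient to (λ i j → to-injective i j)
                                                   (λ j → middle-vanishes (to j)) (suc (fromℕ< k<c₁)) ⟩
    0#                                        ∎
    where
    c = suc c₁
    open FiniteField F c card using (fermat; to-injective)
    open Inverse card using (to)

    B : ℕ → Carrier
    B j = (c C j) times 1#

    coefficient : Fin c → Carrier
    coefficient zero    = 0#
    coefficient (suc j) = B (suc (toℕ j))

    -- The binomial expansion of (a + 1)^c = a + 1 has first term 1, last term a
    -- (Fermat), and middle terms B k · aᵏ, whose sum is therefore 0.
    module _ (a : Carrier) where
      term : Fin (suc c) → Carrier
      term k = (c C toℕ k) times (a ^ toℕ k * 1# ^ (c ∸ toℕ k))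

      term≡ : ∀ k → term k ≡ B (toℕ k) * a ^ toℕ k
      term≡ k = begin
        (c C toℕ k) times (a ^ toℕ k * 1# ^ (c ∸ toℕ k)) ≡⟨ times-scalar (c C toℕ k) _ ⟩
        B (toℕ k) * (a ^ toℕ k * 1# ^ (c ∸ toℕ k))       ≡⟨ cong (λ z → B (toℕ k) * (a ^ toℕ k * z)) (1^ (c ∸ toℕ k)) ⟩
        B (toℕ k) * (a ^ toℕ k * 1#)                     ≡⟨ cong (B (toℕ k) *_) (*-identityʳ _) ⟩
        B (toℕ k) * a ^ toℕ k                            ∎

      middle : Carrier
      middle = ∑ c₁ (λ j → B (suc (toℕ j)) * a ^ suc (toℕ j))

      first-term : term zero ≡ 1#
      first-term = trans (term≡ zero) (trans (cong (_* 1#) (+-identityʳ 1#)) (*-identityˡ 1#))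

      last-term : term (fromℕ c) ≡ a
      last-term = begin
        term (fromℕ c)                         ≡⟨ term≡ (fromℕ c) ⟩
        B (toℕ (fromℕ c)) * a ^ toℕ (fromℕ c)  ≡⟨ cong (λ j → B j * a ^ j) (toℕ-fromℕ c) ⟩
        B c * a ^ c                            ≡⟨ cong₂ _*_ (cong (_times 1#) (nCn≡1 c)) (fermat a) ⟩
        (1# + 0#) * a                          ≡⟨ cong (_* a) (+-identityʳ 1#) ⟩
        1# * a                                 ≡⟨ *-identityˡ a ⟩
        a                                      ∎

      expansion : 1# + (middle + a) ≡ 1# + a
      expansion = begin
        1# + (middle + a)
          ≡⟨ sym (cong₂ (λ u v → u + (v + a)) first-term
               (∑-cong c₁ (λ j → trans (term≡ (suc (inject₁ j)))
                 (cong (λ i → B (suc i) * a ^ suc i) (toℕ-inject₁ j))))) ⟩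
        term zero + (∑ c₁ (λ j → term (suc (inject₁ j))) + a)
          ≡⟨ cong (λ v → term zero + (∑ c₁ (λ j → term (suc (inject₁ j))) + v)) (sym last-term) ⟩
        term zero + (∑ c₁ (λ j → term (suc (inject₁ j))) + term (fromℕ c))
          ≡⟨ cong (term zero +_) (sym (∑-last c₁ (λ j → term (suc j)))) ⟩
        ∑ (suc c) term          ≡⟨ sym (binomial-theorem c a 1#) ⟩
        (a + 1#) ^ c            ≡⟨ fermat (a + 1#) ⟩
        a + 1#                  ≡⟨ +-comm a 1# ⟩
        1# + a                  ∎

      middle-vanishes : horner c coefficient a ≡ 0#
      middle-vanishes = begin
        horner c coefficient a          ≡⟨ horner≡∑ c coefficient a ⟩
        0# * 1# + middle                ≡⟨ cong (_+ middle) (zeroˡ 1#) ⟩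
        0# + middle                     ≡⟨ +-identityˡ middle ⟩
        middle                          ≡⟨ +-identityˡ-unique middle a (+-cancelˡ 1# _ _ expansion) ⟩
        0#                              ∎

module Homomorphism (K L : Field) (ι : Field.Carrier K → Field.Carrier L) (hom : IsFieldHom K L ι) where
  private module K = FieldFacts K
  open FieldFacts L
  open IsFieldHom hom public
  open ≡-Reasoning

  ι-0 : ι K.0# ≡ 0#
  ι-0 = +-identityʳ-unique (ι K.0#) (ι K.0#) (trans (sym (+-homo K.0# K.0#)) (cong ι (K.+-identityʳ K.0#)))

  ι-neg : ∀ a → ι (K.- a) ≡ - ι a
  ι-neg a = +-inverseʳ-unique (ι a) (ι (K.- a))
    (trans (sym (+-homo a (K.- a))) (trans (cong ι (K.-‿inverseʳ a)) ι-0))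

  ι-∑ : ∀ n (f : Fin n → K.Carrier) → ι (K.∑ n f) ≡ ∑ n (λ i → ι (f i))
  ι-∑ = ∑-additive K L ι +-homo ι-0

  ι-^ : ∀ a e → ι (a K.^ e) ≡ ι a ^ e
  ι-^ a zero    = 1-homo
  ι-^ a (suc e) = trans (*-homo a (a K.^ e)) (cong (ι a *_) (ι-^ a e))

  ι-times : ∀ m → ι (m K.times K.1#) ≡ m times 1#
  ι-times zero    = ι-0
  ι-times (suc m) = trans (+-homo K.1# (m K.times K.1#)) (cong₂ _+_ 1-homo (ι-times m))

  -- Frobenius: if K has c elements then x ↦ x^c is additive on L, since the
  -- inner binomial coefficients of (x + y)^c already vanish in K.
  frobenius : ∀ c → Fin c ↔ K.Carrier → ∀ x y → (x + y) ^ c ≡ x ^ c + y ^ c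
  frobenius zero     card x y with Inverse.from card K.0#
  ... | ()
  frobenius (suc c₁) card x y = begin
    (x + y) ^ c                                           ≡⟨ binomial-theorem c x y ⟩
    term zero + ∑ (suc c₁) (λ k → term (suc k))            ≡⟨ cong (term zero +_) (∑-last c₁ (λ k → term (suc k))) ⟩
    term zero + (∑ c₁ (λ k → term (suc (inject₁ k))) + term (fromℕ c))
      ≡⟨ cong₂ (λ u v → term zero + (u + v)) (∑-zero c₁ _ middle-term) last-term ⟩
    term zero + (0# + x ^ c)                              ≡⟨ cong₂ _+_ first-term (+-identityˡ _) ⟩
    y ^ c + x ^ c                                         ≡⟨ +-comm _ _ ⟩
    x ^ c + y ^ c                                         ∎
    where
    c = suc c₁
    open BinomialCoefficients K using (binomial-vanishes)

    term : Fin (suc c) → Carrier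
    term k = (c C toℕ k) times (x ^ toℕ k * y ^ (c ∸ toℕ k))

    first-term : term zero ≡ y ^ c
    first-term = trans (+-identityʳ _) (*-identityˡ _)

    middle-term : ∀ k → term (suc (inject₁ k)) ≡ 0#
    middle-term k = begin
      term (suc (inject₁ k))                ≡⟨ times-scalar (c C j) _ ⟩
      ((c C j) times 1#) * w                ≡⟨ cong (_* w) (sym (ι-times (c C j))) ⟩
      ι ((c C j) K.times K.1#) * w          ≡⟨ cong (λ z → ι z * w) (binomial-vanishes c card j (s≤s z≤n) j<c) ⟩
      ι K.0# * w                            ≡⟨ cong (_* w) ι-0 ⟩
      0# * w                                ≡⟨ zeroˡ w ⟩
      0#                                    ∎
      where
      j = suc (toℕ (inject₁ k))
      w = x ^ j * y ^ (c ∸ j)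
      j<c : j < c
      j<c = s≤s (subst (ℕ._< c₁) (sym (toℕ-inject₁ k)) (toℕ<n k))

    last-term : term (fromℕ c) ≡ x ^ c
    last-term = begin
      term (fromℕ c)                       ≡⟨ cong (λ j → (c C j) times (x ^ j * y ^ (c ∸ j))) (toℕ-fromℕ c) ⟩
      (c C c) times (x ^ c * y ^ (c ∸ c))  ≡⟨ cong₂ (λ m e → m times (x ^ c * y ^ e)) (nCn≡1 c) (ℕ.n∸n≡0 c) ⟩
      (x ^ c * 1#) + 0#                    ≡⟨ +-identityʳ _ ⟩
      x ^ c * 1#                           ≡⟨ *-identityʳ _ ⟩
      x ^ c                                ∎

module Gabidulin {q n : ℕ} (S : Setting q n) where
  open Setting S
  private module K = FieldFacts K
  open FieldFacts L
  open Homomorphism K L ι ι-hom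
  private
    module Kq  = FiniteField K q K-card
    module Lqⁿ = FiniteField L (q ℕ.^ n) L-card
  open ≡-Reasoning

  lc : (r : ℕ) → (Fin r → K.Carrier) → (Fin r → Carrier) → Carrier
  lc = lincomb S

  lc-congˡ : ∀ r {a b : Fin r → K.Carrier} v → (∀ i → a i ≡ b i) → lc r a v ≡ lc r b v
  lc-congˡ r v a≗b = ∑-cong r (λ i → cong (λ z → ι z * v i) (a≗b i))

  lc-congʳ : ∀ r a {v w : Fin r → Carrier} → (∀ i → v i ≡ w i) → lc r a v ≡ lc r a w
  lc-congʳ r a v≗w = ∑-cong r (λ i → cong (ι (a i) *_) (v≗w i))

  -- The q^e-th power map is additive on L and fixes ι(K), by Frobenius and Fermat.
  power-additive : ∀ e x y → (x + y) ^ (q ℕ.^ e) ≡ x ^ (q ℕ.^ e) + y ^ (q ℕ.^ e)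
  power-additive zero    x y = trans (*-identityʳ _) (sym (cong₂ _+_ (*-identityʳ x) (*-identityʳ y)))
  power-additive (suc e) x y = begin
    (x + y) ^ (q ℕ.* Q)               ≡⟨ ^-* (x + y) q Q ⟩
    ((x + y) ^ q) ^ Q                 ≡⟨ cong (_^ Q) (frobenius q K-card x y) ⟩
    (x ^ q + y ^ q) ^ Q               ≡⟨ power-additive e _ _ ⟩
    (x ^ q) ^ Q + (y ^ q) ^ Q         ≡⟨ sym (cong₂ _+_ (^-* x q Q) (^-* y q Q)) ⟩
    x ^ (q ℕ.* Q) + y ^ (q ℕ.* Q)     ∎
    where Q = q ℕ.^ e

  power-fixes : ∀ e a → ι a ^ (q ℕ.^ e) ≡ ι a
  power-fixes zero    a = *-identityʳ _
  power-fixes (suc e) a = begin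
    ι a ^ (q ℕ.* Q)      ≡⟨ ^-* (ι a) q Q ⟩
    (ι a ^ q) ^ Q        ≡⟨ cong (_^ Q) (trans (sym (ι-^ a q)) (cong ι (Kq.fermat a))) ⟩
    ι a ^ Q              ≡⟨ power-fixes e a ⟩
    ι a                  ∎
    where Q = q ℕ.^ e

  power-zero : ∀ e → 0# ^ (q ℕ.^ e) ≡ 0#
  power-zero e = trans (cong (_^ (q ℕ.^ e)) (sym ι-0)) (trans (power-fixes e K.0#) ι-0)

  power-linear : ∀ e r a v → lc r a v ^ (q ℕ.^ e) ≡ lc r a (λ l → v l ^ (q ℕ.^ e))
  power-linear e r a v = begin
    lc r a v ^ Q                      ≡⟨ ∑-additive L L (_^ Q) (power-additive e) (power-zero e) r _ ⟩
    ∑ r (λ l → (ι (a l) * v l) ^ Q)   ≡⟨ ∑-cong r (λ l → trans (*-^ (ι (a l)) (v l) Q)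
                                           (cong (_* v l ^ Q) (power-fixes e (a l)))) ⟩
    lc r a (λ l → v l ^ Q)            ∎
    where Q = q ℕ.^ e

  lc-scale : ∀ b r a v → b * lc r a v ≡ lc r a (λ l → b * v l)
  lc-scale b r a v = trans (∑-*ˡ r b _) (∑-cong r (λ l →
    solve 3 (λ b x y → b :* (x :* y) := x :* (b :* y)) refl b (ι (a l)) (v l)))

  lc-∑ : ∀ t r a (w : Fin t → Fin r → Carrier) → ∑ t (λ i → lc r a (w i)) ≡ lc r a (λ l → ∑ t (λ i → w i l))
  lc-∑ t r a w = begin
    ∑ t (λ i → ∑ r (λ l → ι (a l) * w i l))   ≡⟨ ∑-swap t r _ ⟩
    ∑ r (λ l → ∑ t (λ i → ι (a l) * w i l))   ≡⟨ ∑-cong r (λ l → sym (∑-*ˡ t (ι (a l)) _)) ⟩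
    lc r a (λ l → ∑ t (λ i → w i l))          ∎

  linPoly-linear : ∀ k t c r a v → linPoly S k t c (lc r a v) ≡ lc r a (λ l → linPoly S k t c (v l))
  linPoly-linear k t c r a v = begin
    ∑ t (λ i → c i * lc r a v ^ Q i)              ≡⟨ ∑-cong t (λ i → cong (c i *_) (power-linear (k ℕ.* toℕ i) r a v)) ⟩
    ∑ t (λ i → c i * lc r a (λ l → v l ^ Q i))    ≡⟨ ∑-cong t (λ i → lc-scale (c i) r a _) ⟩
    ∑ t (λ i → lc r a (λ l → c i * v l ^ Q i))    ≡⟨ lc-∑ t r a _ ⟩
    lc r a (λ l → linPoly S k t c (v l))          ∎
    where
    Q : Fin t → ℕ
    Q i = q ℕ.^ (k ℕ.* toℕ i)

  lc-matrix : ∀ m p a (A : Fin m → Fin p → K.Carrier) v →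
    lc m a (λ i → lc p (A i) v) ≡ lc p (λ l → K.∑ m (λ i → a i K.* A i l)) v
  lc-matrix m p a A v = begin
    ∑ m (λ i → ι (a i) * ∑ p (λ l → ι (A i l) * v l))     ≡⟨ ∑-cong m (λ i → ∑-*ˡ p (ι (a i)) _) ⟩
    ∑ m (λ i → ∑ p (λ l → ι (a i) * (ι (A i l) * v l)))   ≡⟨ ∑-swap m p _ ⟩
    ∑ p (λ l → ∑ m (λ i → ι (a i) * (ι (A i l) * v l)))
      ≡⟨ ∑-cong p (λ l → ∑-cong m (λ i → trans (sym (*-assoc _ _ _)) (cong (_* v l) (sym (*-homo _ _))))) ⟩
    ∑ p (λ l → ∑ m (λ i → ι (a i K.* A i l) * v l))
      ≡⟨ ∑-cong p (λ l → trans (sym (∑-*ʳ m (v l) _)) (cong (_* v l) (sym (ι-∑ m _)))) ⟩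
    lc p (λ l → K.∑ m (λ i → a i K.* A i l)) v            ∎

  lc-+ : ∀ r a b v → lc r a v + lc r b v ≡ lc r (λ i → a i K.+ b i) v
  lc-+ r a b v = trans (sym (∑-+ r _ _)) (∑-cong r (λ i → begin
    ι (a i) * v i + ι (b i) * v i  ≡⟨ sym (distribʳ (v i) _ _) ⟩
    (ι (a i) + ι (b i)) * v i      ≡⟨ cong (_* v i) (sym (+-homo _ _)) ⟩
    ι (a i K.+ b i) * v i          ∎))

  coordinates-unique : ∀ r (u : Fin r → Carrier) → LinIndep S r u →
    ∀ a b → lc r a u ≡ lc r b u → ∀ j → a j ≡ b j
  coordinates-unique r u u-indep a b same j = K.x∙y⁻¹≈ε⇒x≈y (a j) (b j) (u-indep (λ i → a i K.- b i) diff≡0 j)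
    where
    a-b+b≡a : ∀ i → (a i K.- b i) K.+ b i ≡ a i
    a-b+b≡a i = trans (K.+-assoc _ _ _) (trans (cong (a i K.+_) (K.-‿inverseˡ (b i))) (K.+-identityʳ (a i)))
    diff≡0 : lc r (λ i → a i K.- b i) u ≡ 0#
    diff≡0 = +-identityˡ-unique _ (lc r b u)
      (trans (lc-+ r _ b u) (trans (lc-congˡ r u a-b+b≡a) same))

  -- Puncturing the generalized Gabidulin code of (D : n points g) by a full
  -- row rank A gives the generalized Gabidulin code on the m points A g: by
  -- linearity of F, the rows of A M are the coordinates of F(A g).
  module Puncturing {m t} (D : GGData S n t) (A : Matrix S m n)
                    (t≤m : t ≤ m) (A-rank : HasFullRowRank S m n A) where
    open GGData D hiding (t≤m)

    g′ : Fin m → Carrier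
    g′ i = lc n (A i) g

    -- A relation among the A g is a relation among the rows of A.
    g′-independent : LinIndep S m g′
    g′-independent a rel = A-rank a (g-indep _ (trans (sym (lc-matrix m n a A g)) rel))

    D′ : GGData S m t
    D′ = record { t-pos = t-pos ; t≤m = t≤m ; g = g′ ; g-indep = g′-independent
                ; k = k ; k-pos = k-pos ; k-coprime = k-coprime ; u = u ; u-basis = u-basis }

    punctured-rows : ∀ (M : Matrix S n n) c → (∀ l → lc n (M l) u ≡ linPoly S k t c (g l)) →
      ∀ i → lc n (_·_ S A M i) u ≡ linPoly S k t c (g′ i)
    punctured-rows M c rows i = begin
      lc n (_·_ S A M i) u                         ≡⟨ sym (lc-matrix n n (A i) M u) ⟩
      lc n (A i) (λ l → lc n (M l) u)              ≡⟨ lc-congʳ n (A i) rows ⟩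
      lc n (A i) (λ l → linPoly S k t c (g l))     ≡⟨ sym (linPoly-linear k t c n (A i) g) ⟩
      linPoly S k t c (g′ i)                       ∎

    puncture-isGG : IsGG S m t (Puncture S A (GGCode S n t D))
    puncture-isGG = D′ , λ N → into N , out-of N
      where
      into : ∀ N → Puncture S A (GGCode S n t D) N → GGCode S m t D′ N
      into N (M , (c , rows) , AM≡N) = c , λ i →
        trans (lc-congˡ n u (λ j → sym (AM≡N i j))) (punctured-rows M c rows i)

      out-of : ∀ N → GGCode S m t D′ N → Puncture S A (GGCode S n t D) N
      out-of N (c , rows) = M , (c , M-rows) , λ i j →
        coordinates-unique n u (proj₁ u-basis) _ (N i) (trans (punctured-rows M c M-rows i) (sym (rows i))) j
        where
        M : Matrix S n n
        M l = proj₁ (proj₂ u-basis (linPoly S k t c (g l)))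
        M-rows : ∀ l → lc n (M l) u ≡ linPoly S k t c (g l)
        M-rows l = proj₂ (proj₂ u-basis (linPoly S k t c (g l)))

  -- Whether x lies in the translate y + span(g) is decidable: K is finite, so
  -- the coefficient of each gᵢ can be found by exhaustive search.
  translate-span? : ∀ m (g : Fin m → Carrier) y x → Dec (Σ (Fin m → K.Carrier) λ a → y + lc m a g ≡ x)
  translate-span? zero    g y x with (y + 0#) Lqⁿ.≟ x
  ... | yes y+0≡x = yes ((λ ()) , y+0≡x)
  ... | no  y+0≢x = no λ { (a , y+0≡x) → y+0≢x y+0≡x }
  translate-span? (suc m) g y x
    with any? (λ i → translate-span? m (λ j → g (suc j)) (y + ι (Kq.to i) * g zero) x)
  ... | yes (i , a , eq) = yes ((Kq.to i ∷ a) , trans (sym (+-assoc _ _ _)) eq)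
  ... | no  none         = no λ { (a , eq) → none (Kq.from (a zero) , (λ j → a (suc j)) ,
          trans (cong (λ z → (y + ι z * g zero) + lc m (λ j → a (suc j)) (λ j → g (suc j)))
                      (Kq.strictlyInverseˡ (a zero)))
                (trans (+-assoc _ _ _) eq)) }

  InSpan : ∀ m → (Fin m → Carrier) → Carrier → Set
  InSpan m g x = Σ (Fin m → K.Carrier) λ a → lc m a g ≡ x

  in-span? : ∀ m g x → Dec (InSpan m g x)
  in-span? m g x = map′ (λ { (a , eq) → a , trans (sym (+-identityˡ _)) eq })
                        (λ { (a , eq) → a , trans (+-identityˡ _) eq })
                        (translate-span? m g 0# x)

  -- Fewer than n elements do not span F_{q^n}: otherwise choosing coordinates
  -- would inject the q^n elements of L into the q^m coefficient vectors.
  small-span-proper : ∀ m → m < n → (g : Fin m → Carrier) → ¬ (∀ x → InSpan m g x)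
  small-span-proper m m<n g spans = ℕ.<⇒≱ (ℕ.^-monoʳ-< q 1<q m<n) (injective⇒≤ code-injective)
    where
    1<q : 1 < q
    1<q = subst (1 <_) (sym (proj₂ Kq.card≡2+)) (s≤s (s≤s z≤n))
    coefficients : Fin (q ℕ.^ n) → Fin m → K.Carrier
    coefficients i = proj₁ (spans (Lqⁿ.to i))
    code : Fin (q ℕ.^ n) → Fin (q ℕ.^ m)
    code i = Fin.funToFin (λ j → Kq.from (coefficients i j))
    code-injective : ∀ {i i′} → code i ≡ code i′ → i ≡ i′
    code-injective {i} {i′} same = Lqⁿ.to-injective i i′ (begin
      Lqⁿ.to i                    ≡⟨ sym (proj₂ (spans (Lqⁿ.to i))) ⟩
      lc m (coefficients i) g     ≡⟨ lc-congˡ m g (λ j → Kq.from-injective _ _ (begin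
          Kq.from (coefficients i j)   ≡⟨ sym (finToFun-funToFin _ j) ⟩
          Fin.finToFun (code i) j      ≡⟨ cong (λ z → Fin.finToFun z j) same ⟩
          Fin.finToFun (code i′) j     ≡⟨ finToFun-funToFin _ j ⟩
          Kq.from (coefficients i′ j)  ∎)) ⟩
      lc m (coefficients i′) g    ≡⟨ proj₂ (spans (Lqⁿ.to i′)) ⟩
      Lqⁿ.to i′                   ∎)

  outside-span : ∀ m → m < n → (g : Fin m → Carrier) → Σ Carrier λ v → ¬ InSpan m g v
  outside-span m m<n g with ¬∀⟶∃¬ (q ℕ.^ n) (λ i → InSpan m g (Lqⁿ.to i)) (λ i → in-span? m g (Lqⁿ.to i))
                              (λ all → small-span-proper m m<n g (λ x →
                                 subst (InSpan m g) (Lqⁿ.strictlyInverseˡ x) (all (Lqⁿ.from x))))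
  ... | i , v∉ = Lqⁿ.to i , v∉

  solve-for : ∀ m (g : Fin m → Carrier) v a₀ (a : Fin m → K.Carrier) →
    a₀ ≢ K.0# → ι a₀ * v + lc m a g ≡ 0# → InSpan m g v
  solve-for m g v a₀ a a₀≢0 rel = (λ j → K.- b K.* a j) , (begin
    lc m (λ j → K.- b K.* a j) g
      ≡⟨ ∑-cong m (λ j → trans (cong (_* g j) (*-homo _ _)) (*-assoc _ _ _)) ⟩
    ∑ m (λ j → ι (K.- b) * (ι (a j) * g j))  ≡⟨ sym (∑-*ˡ m _ _) ⟩
    ι (K.- b) * lc m a g                      ≡⟨ cong₂ _*_ (ι-neg b) (+-inverseʳ-unique _ _ rel) ⟩
    (- ι b) * (- (ι a₀ * v))                  ≡⟨ sym (-‿distribˡ-* (ι b) _) ⟩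
    - (ι b * - (ι a₀ * v))                    ≡⟨ cong -_ (trans (*-comm _ _) (sym (-‿distribˡ-* _ _))) ⟩
    - (- ((ι a₀ * v) * ι b))                  ≡⟨ -‿involutive _ ⟩
    (ι a₀ * v) * ι b                          ≡⟨ solve 3 (λ x v y → (x :* v) :* y := (x :* y) :* v) refl (ι a₀) v (ι b) ⟩
    (ι a₀ * ι b) * v                          ≡⟨ cong (_* v) (trans (sym (*-homo a₀ b)) (trans (cong ι a₀b≡1) 1-homo)) ⟩
    1# * v                                    ≡⟨ *-identityˡ v ⟩
    v                                         ∎)
    where
    b = proj₁ (K.inverse a₀ a₀≢0)
    a₀b≡1 = proj₂ (K.inverse a₀ a₀≢0)

  adjoin-independent : ∀ m (g : Fin m → Carrier) → LinIndep S m g →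
    ∀ v → ¬ InSpan m g v → LinIndep S (suc m) (v ∷ g)
  adjoin-independent m g g-indep v v∉ a rel with a zero Kq.≟ K.0#
  ... | no  a₀≢0 = ⊥-elim (v∉ (solve-for m g v (a zero) (λ j → a (suc j)) a₀≢0 rel))
  ... | yes a₀≡0 = λ { zero → a₀≡0 ; (suc j) → g-indep (λ j → a (suc j)) rest≡0 j }
    where
    rest≡0 : lc m (λ j → a (suc j)) g ≡ 0#
    rest≡0 = begin
      lc m (λ j → a (suc j)) g                 ≡⟨ sym (+-identityˡ _) ⟩
      0# + lc m (λ j → a (suc j)) g            ≡⟨ cong (_+ lc m (λ j → a (suc j)) g)
                                                    (sym (trans (cong (λ z → ι z * v) a₀≡0) (trans (cong (_* v) ι-0) (zeroˡ v)))) ⟩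
      ι (a zero) * v + lc m (λ j → a (suc j)) g ≡⟨ rel ⟩
      0#                                        ∎

  record IndependentExtension (m : ℕ) (g : Fin m → Carrier) : Set where
    field
      family             : Fin n → Carrier
      independent        : LinIndep S n family
      position           : Fin m → Fin n
      position-injective : ∀ i j → position i ≡ position j → i ≡ j
      extends            : ∀ i → family (position i) ≡ g i

  -- Every independent family extends to n independent elements, adjoining
  -- elements outside the span d = n - m times.
  extend : ∀ d m (g : Fin m → Carrier) → LinIndep S m g → d ℕ.+ m ≡ n → IndependentExtension m g
  extend zero    m g g-indep refl = record
    { family = g ; independent = g-indep ; position = λ i → i
    ; position-injective = λ i j i≡j → i≡j ; extends = λ i → refl }
  extend (suc d) m g g-indep d+m≡n = record
    { family = family ; independent = independent ; position = λ i → position (suc i)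
    ; position-injective = λ i j eq → suc-injective (position-injective (suc i) (suc j) eq)
    ; extends = λ i → extends (suc i) }
    where
    m<n : m < n
    m<n = subst (m <_) d+m≡n (ℕ.m<n+m m (s≤s z≤n))
    v = proj₁ (outside-span m m<n g)
    open IndependentExtension (extend d (suc m) (v ∷ g)
      (adjoin-independent m g g-indep v (proj₂ (outside-span m m<n g)))
      (trans (ℕ.+-suc d m) d+m≡n))

  -- Conversely, a generalized Gabidulin code on m points g is the puncturing of
  -- the one on an independent extension of g to n points, by the matrix
  -- selecting the rows at the positions of g.
  module Unpuncturing {m t} (D : GGData S m t) (m≤n : m ≤ n) where
    open GGData D
    open IndependentExtension (extend (n ∸ m) m g g-indep (ℕ.m∸n+n≡m m≤n))

    D′ : GGData S n t
    D′ = record { t-pos = t-pos ; t≤m = ℕ.≤-trans t≤m m≤n ; g = family ; g-indep = independent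
                ; k = k ; k-pos = k-pos ; k-coprime = k-coprime ; u = u ; u-basis = u-basis }

    selection : Matrix S m n
    selection i l = K.δ (position i) l

    selected-rows : ∀ (M : Matrix S n n) i j → _·_ S selection M i j ≡ M (position i) j
    selected-rows M i j = K.∑-δ n (position i) (λ l → M l j)

    δ-positions : ∀ i′ i → K.δ (position i′) (position i) ≡ K.δ i i′
    δ-positions i′ i with i′ Fin.≟ i
    ... | yes refl  = trans (K.δ-diagonal (position i)) (sym (K.δ-diagonal i))
    ... | no  i′≢i  = trans (K.δ-off-diagonal _ _ (λ eq → i′≢i (position-injective i′ i eq)))
                            (sym (K.δ-off-diagonal i i′ (λ eq → i′≢i (sym eq))))

    -- Column (position i) of the selection matrix is the i-th unit vector,
    -- so a vanishing combination of its rows has zero coefficients.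
    selection-rank : HasFullRowRank S m n selection
    selection-rank a rel i = begin
      a i                                                    ≡⟨ sym (K.∑-δ m i a) ⟩
      K.∑ m (λ i′ → K.δ i i′ K.* a i′)                        ≡⟨ K.∑-cong m (λ i′ →
                                                                   trans (cong (K._* a i′) (sym (δ-positions i′ i))) (K.*-comm _ _)) ⟩
      K.∑ m (λ i′ → a i′ K.* K.δ (position i′) (position i))  ≡⟨ rel (position i) ⟩
      K.0#                                                   ∎

    into : ∀ N → GGCode S m t D N → Puncture S selection (GGCode S n t D′) N
    into N (c , rows) = M , (c , M-rows) , λ i j → trans (selected-rows M i j)
      (coordinates-unique n u (proj₁ u-basis) _ _
        (trans (M-rows (position i)) (trans (cong (linPoly S k t c) (extends i)) (sym (rows i)))) j)
      where
      M : Matrix S n n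
      M l = proj₁ (proj₂ u-basis (linPoly S k t c (family l)))
      M-rows : ∀ l → lc n (M l) u ≡ linPoly S k t c (family l)
      M-rows l = proj₂ (proj₂ u-basis (linPoly S k t c (family l)))

    out-of : ∀ N → Puncture S selection (GGCode S n t D′) N → GGCode S m t D N
    out-of N (M , (c , rows) , SM≡N) = c , λ i → begin
      lc n (N i) u                          ≡⟨ lc-congˡ n u (λ j → trans (sym (SM≡N i j)) (selected-rows M i j)) ⟩
      lc n (M (position i)) u               ≡⟨ rows (position i) ⟩
      linPoly S k t c (family (position i)) ≡⟨ cong (linPoly S k t c) (extends i) ⟩
      linPoly S k t c (g i)                 ∎

theorem3p4 : ∀ {q n} (S : Setting q n) →
    (∀ m t (D : GGData S n t) (A : Matrix S m n) →
      t < m → m ≤ n → HasFullRowRank S m n A →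
      IsGG S m t (Puncture S A (GGCode S n t D)))
    ×
    (∀ m t (D : GGData S m t) → m ≤ n →
      Σ (GGData S n t) λ D′ → Σ (Matrix S m n) λ A →
        HasFullRowRank S m n A ×
        (∀ M → (GGCode S m t D M → Puncture S A (GGCode S n t D′) M)
             × (Puncture S A (GGCode S n t D′) M → GGCode S m t D M)))
theorem3p4 S =
  (λ m t D A t<m _ A-rank → Puncturing.puncture-isGG D A (ℕ.<⇒≤ t<m) A-rank) ,
  (λ m t D m≤n → let open Unpuncturing D m≤n in
     D′ , selection , selection-rank , λ M → into M , out-of M)
  where open Gabidulin S
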